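{- Let $A\subseteq\mathbb{Q}$ and let $\alpha\in\omega^\omega$ be an enumeration of $A$. If $$\forall\gamma\in\omega^\omega\;\exists n\Big[\forall i\le n+1[\alpha(\gamma(i))>0]\rightarrow q_{\alpha(\gamma(n))-1}\le q_{\alpha(\gamma(n+1))-1}\Big],$$ then $A\in\mathcal{WO}$.
   Context: Setting: intuitionistic mathematics (intuitionistic logic), assuming the axioms of countable choice and Brouwer's Bar Theorem, in the forms: (a) if $B\subseteq\omega$ is a bar in $\omega^\omega$ (i.e. $\forall\gamma\exists n[\overline{\gamma}n\in B]$), there is a stump $S$ such that $S\cap B$ is a bar in $\omega^\omega$; (b) Bar Induction: if $B,C\subseteq\omega$, $B$ is a bar in $\omega^\omega$, $B\subseteq C$ and $\forall s[s\in C\leftrightarrow\forall n[s\ast\langle n\rangle\in C]]$, then $\langle\,\rangle\in C$. (Finite sequences are coded by natural numbers, $\overline{\gamma}n=\langle\gamma(0),\dots,\gamma(n-1)\rangle$; stumps are the least class of subsets of $\omega$ containing $\emptyset$ and closed under $S_0,S_1,\ldots\mapsto\{\langle\,\rangle\}\cup\bigcup_n\langle n\rangle\ast S_n$, with induction over stumps.) Let $q_0,q_1,\dots$ be a fixed enumeration of $\mathbb{Q}$ without repetitions. $\alpha$ is an enumeration of $A\subseteq\mathbb{Q}$ iff $\forall n[q_n\in A\leftrightarrow\exists m[\alpha(m)=n+1]]$. For $A,B\subseteq\mathbb{Q}$, $A<B$ iff $\forall q\in A\forall r\in B[q<r]$. $\mathcal{WO}$ (inductively well-ordered subsets of $\mathbb{Q}$)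 is the least collection of subsets of $\mathbb{Q}$ containing $\emptyset$ and every singleton $\{q\}$, and containing $\bigcup_nA_n$ whenever $A_0,A_1,\dots$ is a sequence of elements of $\mathcal{WO}$ with $A_n<A_{n+1}$ for all $n$. -}

module Defs where

open import Data.Nat using (ℕ; zero; suc; _∸_; _≤_; _>_)
open import Data.List using (List; []; _∷_; _++_; [_])
open import Data.Rational using (ℚ) renaming (_<_ to _<ℚ_; _≤_ to _≤ℚ_)
open import Data.Product using (Σ; ∃; _×_; _,_)
open import Data.Empty using (⊥)
open import Data.Unit using (⊤)
open import Relation.Binary.PropositionalEquality using (_≡_)
open import Function.Bundles using (_⇔_)
open import Function.Definitions using (Injective; Surjective)

IsEnumerationOfℚ : (ℕ → ℚ) → Set
IsEnumerationOfℚ q = Injective _≡_ _≡_ q × Surjective _≡_ _≡_ q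

Enumerates : (ℕ → ℚ) → (ℕ → ℕ) → (ℚ → Set) → Set
Enumerates q α A = ∀ n → (A (q n) ⇔ ∃ λ m → α m ≡ suc n)

_<ˢ_ : (ℚ → Set) → (ℚ → Set) → Set
A <ˢ B = ∀ x y → A x → B y → x <ℚ y

-- Inductively well-ordered subsets of ℚ (least class containing ∅,
-- singletons, and unions of <-increasing sequences), closed under
-- extensional equality of subsets.
data WO : (ℚ → Set) → Set₁ where
  wo-empty  : ∀ {A} → (∀ x → A x → ⊥) → WO A
  wo-single : ∀ {A} (r : ℚ) → (∀ x → (A x ⇔ x ≡ r)) → WO A
  wo-union  : ∀ {A} (B : ℕ → ℚ → Set) → (∀ n → WO (B n))
            → (∀ n → B n <ˢ B (suc n))
            → (∀ x → (A x ⇔ ∃ λ n → B n x)) → WO A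

initSeg : (ℕ → ℕ) → ℕ → List ℕ
initSeg γ zero    = []
initSeg γ (suc n) = initSeg γ n ++ [ γ n ]

IsBar : (List ℕ → Set) → Set
IsBar B = ∀ (γ : ℕ → ℕ) → ∃ λ n → B (initSeg γ n)

data Stump : Set where
  empty : Stump
  node  : (ℕ → Stump) → Stump

_∈ˢᵗ_ : List ℕ → Stump → Set
s       ∈ˢᵗ empty  = ⊥
[]      ∈ˢᵗ node f = ⊤
(n ∷ s) ∈ˢᵗ node f = s ∈ˢᵗ f n

BarTheoremStump : Set₁
BarTheoremStump = ∀ (B : List ℕ → Set) → IsBar B →
  Σ Stump λ S → IsBar (λ s → s ∈ˢᵗ S × B s)

BarInduction : Set₁
BarInduction = ∀ (B C : List ℕ → Set) → IsBar B → (∀ s → B s → C s) →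
  (∀ s → (C s ⇔ (∀ n → C (s ++ [ n ])))) → C []

Hyp : (ℕ → ℚ) → (ℕ → ℕ) → Set
Hyp q α = ∀ (γ : ℕ → ℕ) → ∃ λ n →
  ((∀ i → i ≤ suc n → α (γ i) > 0) →
   q (α (γ n) ∸ 1) ≤ℚ q (α (γ (suc n)) ∸ 1))

-- Read a finite sequence of indices n through v n = q (α n − 1), and call it bad
-- when it is not a strictly decreasing chain of elements of A.  The hypothesis
-- says exactly that the bad sequences form a bar, so by the Bar Theorem some
-- stump S already bars them.  Induction on S shows A ∩ (−∞, b) ∈ WO for every
-- bound b below which S bars the descending chains: A ∩ (−∞, b) is the union of
-- the increasing pieces D n = {x ∈ A | x ≤ v n and x > v m for each admissible
-- m < n}, and D n arises from A ∩ (−∞, v n), which the subtree of S at n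
-- handles, by adding v n and cutting down to a decidable set.
module Submission where

open import Defs
open import Data.Nat as ℕ using (ℕ; zero; suc; _∸_; _≤_; _<_; _>_; s≤s; s≤s⁻¹; z<s)
open import Data.Nat.Properties using (n<1+n)
open import Data.Rational using (ℚ) renaming (_<_ to _<ℚ_; _≤_ to _≤ℚ_)
open import Data.Rational.Properties
  using (_<?_; <-cmp; <⇒≤; <-irrefl; ≤-<-trans; <-≤-trans; ≤-refl; ≮⇒≥)
open import Data.List using (List; []; _∷_; _++_; [_])
open import Data.Maybe using (Maybe; nothing; just)
open import Data.Product using (∃; _×_; _,_; proj₁; proj₂)
open import Data.Sum using (_⊎_; inj₁; inj₂)
open import Data.Empty using (⊥; ⊥-elim)
open import Data.Unit using (⊤; tt)
open import Relation.Nullary using (yes; no; ¬_)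
open import Relation.Nullary.Decidable using (_×-dec_)
open import Relation.Unary using (Decidable; _∩_; _∪_)
open import Relation.Binary using (tri<; tri≈; tri>)
open import Relation.Binary.PropositionalEquality using (_≡_; refl; cong; subst; sym)
open import Function.Bundles using (_⇔_; mk⇔; Equivalence)
open import Function.Definitions using (Surjective)
open import Function.Properties.Equivalence using () renaming (sym to ⇔-sym; trans to ⇔-trans)
open Equivalence

≤⇒<⊎≡ : ∀ {x y : ℚ} → x ≤ℚ y → x <ℚ y ⊎ x ≡ y
≤⇒<⊎≡ {x} {y} x≤y with <-cmp x y
... | tri< x<y _ _ = inj₁ x<y
... | tri≈ _ x≡y _ = inj₂ x≡y
... | tri> _ _ y<x = ⊥-elim (<-irrefl refl (≤-<-trans x≤y y<x))

WO-resp-⇔ : ∀ {X Y : ℚ → Set} → WO X → (∀ x → X x ⇔ Y x) → WO Y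
WO-resp-⇔ (wo-empty X-empty)   X⇔Y = wo-empty (λ x y → X-empty x (from (X⇔Y x) y))
WO-resp-⇔ (wo-single r X≡r)    X⇔Y = wo-single r (λ x → ⇔-trans (⇔-sym (X⇔Y x)) (X≡r x))
WO-resp-⇔ (wo-union B B-wo B< X≡⋃B) X⇔Y =
  wo-union B B-wo B< (λ x → ⇔-trans (⇔-sym (X⇔Y x)) (X≡⋃B x))

WO-∩ : ∀ {X P : ℚ → Set} → WO X → Decidable P → WO (X ∩ P)
WO-∩ (wo-empty X-empty) P? = wo-empty (λ x (Xx , _) → X-empty x Xx)
WO-∩ {P = P} (wo-single r X≡r) P? with P? r
... | yes Pr = wo-single r (λ x → mk⇔ (λ (Xx , _) → to (X≡r x) Xx)
                                      (λ { refl → from (X≡r r) refl , Pr }))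
... | no ¬Pr = wo-empty (λ x (Xx , Px) → ¬Pr (subst P (to (X≡r x) Xx) Px))
WO-∩ (wo-union B B-wo B< X≡⋃B) P? =
  wo-union (λ n → B n ∩ _) (λ n → WO-∩ (B-wo n) P?)
    (λ n x y (Bx , _) (By , _) → B< n x y Bx By)
    (λ x → mk⇔ (λ (Xx , Px) → let (n , Bnx) = to (X≡⋃B x) Xx in n , Bnx , Px)
               (λ (n , Bnx , Px) → from (X≡⋃B x) (n , Bnx) , Px))

WO-∪-max : ∀ {X : ℚ → Set} (t : ℚ) → WO X → (∀ x → X x → x <ℚ t) → WO (X ∪ (_≡ t))
WO-∪-max {X} t X-wo X<t = wo-union B B-wo B< X∪t≡⋃B
  where
  B : ℕ → ℚ → Set
  B zero          = X
  B (suc zero)    = _≡ t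
  B (suc (suc _)) = λ _ → ⊥

  B-wo : ∀ n → WO (B n)
  B-wo zero          = X-wo
  B-wo (suc zero)    = wo-single t (λ _ → mk⇔ (λ e → e) (λ e → e))
  B-wo (suc (suc _)) = wo-empty (λ _ ())

  B< : ∀ n → B n <ˢ B (suc n)
  B< zero          x _ Xx refl = X<t x Xx
  B< (suc zero)    _ _ _  ()
  B< (suc (suc _)) _ _ () _

  X∪t≡⋃B : ∀ x → (X ∪ (_≡ t)) x ⇔ ∃ λ n → B n x
  X∪t≡⋃B x = mk⇔ (λ { (inj₁ Xx) → zero , Xx ; (inj₂ x≡t) → suc zero , x≡t })
                 (λ { (zero , Xx) → inj₁ Xx ; (suc zero , x≡t) → inj₂ x≡t })

prepend : ℕ → (ℕ → ℕ) → ℕ → ℕ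
prepend n γ zero    = n
prepend n γ (suc i) = γ i

initSeg-suc : ∀ γ k → initSeg γ (suc k) ≡ γ 0 ∷ initSeg (λ i → γ (suc i)) k
initSeg-suc γ zero    = refl
initSeg-suc γ (suc k) = cong (_++ [ γ (suc k) ]) (initSeg-suc γ k)

-- The index n stands for the rational v n when Valid n; nothing is the bound +∞.
module Descent (v : ℕ → ℚ) {Valid : ℕ → Set} (valid? : Decidable Valid) where

  Below : Maybe ℚ → ℚ → Set
  Below nothing  x = ⊤
  Below (just r) x = x <ℚ r

  below? : ∀ b → Decidable (Below b)
  below? nothing  x = yes tt
  below? (just r) x = x <? r

  Below-≤ : ∀ b {x y} → x ≤ℚ y → Below b y → Below b x
  Below-≤ nothing  _   _   = tt
  Below-≤ (just r) x≤y y<r = ≤-<-trans x≤y y<r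

  Admissible : Maybe ℚ → ℕ → Set
  Admissible b n = Valid n × Below b (v n)

  admissible? : ∀ b → Decidable (Admissible b)
  admissible? b n = valid? n ×-dec below? b (v n)

  BreaksDescent : Maybe ℚ → List ℕ → Set
  BreaksDescent b []      = ⊥
  BreaksDescent b (n ∷ s) = ¬ Admissible b n ⊎ BreaksDescent (just (v n)) s

  previous : Maybe ℚ → (ℕ → ℕ) → ℕ → Maybe ℚ
  previous b γ zero    = b
  previous b γ (suc i) = just (v (γ i))

  breaksDescent-or-descends : ∀ b γ k →
    BreaksDescent b (initSeg γ k) ⊎ (∀ i → i < k → Admissible (previous b γ i) (γ i))
  breaksDescent-or-descends b γ zero = inj₂ (λ _ ())
  breaksDescent-or-descends b γ (suc k) rewrite initSeg-suc γ k with admissible? b (γ 0)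
  ... | no ¬adm = inj₁ (inj₁ ¬adm)
  ... | yes adm with breaksDescent-or-descends (just (v (γ 0))) (λ i → γ (suc i)) k
  ...   | inj₁ breaks   = inj₁ (inj₂ breaks)
  ...   | inj₂ descends = inj₂ λ where
          zero          _     → adm
          (suc zero)    1<1+k → descends zero (s≤s⁻¹ 1<1+k)
          (suc (suc i)) i<k   → descends (suc i) (s≤s⁻¹ i<k)

  breaksDescent-isBar :
    (∀ γ → ∃ λ n → ((∀ i → i ≤ suc n → Valid (γ i)) → v (γ n) ≤ℚ v (γ (suc n)))) →
    IsBar (BreaksDescent nothing)
  breaksDescent-isBar no-descent γ with n , descent-stops ← no-descent γ
    with breaksDescent-or-descends nothing γ (suc (suc n))
  ... | inj₁ breaks   = suc (suc n) , breaks
  ... | inj₂ descends = ⊥-elim (<-irrefl refl (<-≤-trans v₁<v₀ v₀≤v₁))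
    where
    v₀≤v₁ = descent-stops (λ i i≤1+n → proj₁ (descends i (s≤s i≤1+n)))
    v₁<v₀ = proj₂ (descends (suc n) (n<1+n (suc n)))

  bar-below : ∀ {f b n} → Admissible b n →
    IsBar (λ s → s ∈ˢᵗ node f × BreaksDescent b s) →
    IsBar (λ s → s ∈ˢᵗ f n × BreaksDescent (just (v n)) s)
  bar-below {f} {b} {n} adm bar γ with bar (prepend n γ)
  ... | suc k , barred
    with subst (λ s → s ∈ˢᵗ node f × BreaksDescent b s) (initSeg-suc (prepend n γ) k) barred
  ...   | s∈ , inj₁ ¬adm  = ⊥-elim (¬adm adm)
  ...   | s∈ , inj₂ breaks = k , s∈ , breaks

  module _ {A : ℚ → Set} (v-∈ : ∀ {n} → Valid n → A (v n))
           (∈-v : ∀ {x} → A x → ∃ λ n → Valid n × v n ≡ x) where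

    WO-≤ : ∀ {n} → Valid n → WO (A ∩ Below (just (v n))) → WO (A ∩ (_≤ℚ v n))
    WO-≤ {n} valid A<vn-wo =
      WO-resp-⇔ (WO-∪-max (v n) A<vn-wo (λ _ → proj₂)) (λ x → mk⇔ to′ from′)
      where
      to′ : ∀ {x} → ((A ∩ Below (just (v n))) ∪ (_≡ v n)) x → (A ∩ (_≤ℚ v n)) x
      to′ (inj₁ (Ax , x<vn)) = Ax , <⇒≤ x<vn
      to′ (inj₂ refl)        = v-∈ valid , ≤-refl
      from′ : ∀ {x} → (A ∩ (_≤ℚ v n)) x → ((A ∩ Below (just (v n))) ∪ (_≡ v n)) x
      from′ (Ax , x≤vn) with ≤⇒<⊎≡ x≤vn
      ... | inj₁ x<vn = inj₁ (Ax , x<vn)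
      ... | inj₂ x≡vn = inj₂ x≡vn

    module _ (b : Maybe ℚ) where

      Fresh : ℕ → ℚ → Set
      Fresh zero    x = ⊤
      Fresh (suc k) x = Fresh k x × (Admissible b k → v k <ℚ x)

      fresh? : ∀ k → Decidable (Fresh k)
      fresh? zero    x = yes tt
      fresh? (suc k) x with fresh? k x | admissible? b k | v k <? x
      ... | no ¬fresh | _       | _       = no (λ fresh → ¬fresh (proj₁ fresh))
      ... | yes fresh | no ¬adm | _       = yes (fresh , λ adm → ⊥-elim (¬adm adm))
      ... | yes fresh | yes _   | yes vk<x = yes (fresh , λ _ → vk<x)
      ... | yes fresh | yes adm | no vk≮x  = no (λ fresh′ → vk≮x (proj₂ fresh′ adm))

      fresh-or-first-above : ∀ x k →
        Fresh k x ⊎ ∃ λ n → Admissible b n × x ≤ℚ v n × Fresh n x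
      fresh-or-first-above x zero = inj₁ tt
      fresh-or-first-above x (suc k) with fresh-or-first-above x k
      ... | inj₂ above = inj₂ above
      ... | inj₁ fresh with admissible? b k
      ...   | no ¬adm = inj₁ (fresh , λ adm → ⊥-elim (¬adm adm))
      ...   | yes adm with v k <? x
      ...     | yes vk<x = inj₁ (fresh , λ _ → vk<x)
      ...     | no vk≮x  = inj₂ (k , adm , ≮⇒≥ vk≮x , fresh)

      Piece : ℕ → ℚ → Set
      Piece n x = Admissible b n × ((A ∩ (_≤ℚ v n)) ∩ Fresh n) x

      Piece-< : ∀ n → Piece n <ˢ Piece (suc n)
      Piece-< n x y (adm , (_ , x≤vn) , _) (_ , _ , (_ , vn<y)) = ≤-<-trans x≤vn (vn<y adm)

      ⋃-Piece : ∀ x → (A ∩ Below b) x ⇔ ∃ λ n → Piece n x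
      ⋃-Piece x = mk⇔ cover (λ (n , adm , (Ax , x≤vn) , _) → Ax , Below-≤ b x≤vn (proj₂ adm))
        where
        cover : (A ∩ Below b) x → ∃ λ n → Piece n x
        cover (Ax , x<b) with ∈-v Ax
        ... | m , valid , refl with fresh-or-first-above (v m) (suc m)
        ...   | inj₁ fresh = ⊥-elim (<-irrefl refl (proj₂ fresh (valid , x<b)))
        ...   | inj₂ (n , adm , x≤vn , fresh) = n , adm , (Ax , x≤vn) , fresh

      WO-below-step : (∀ n → Admissible b n → WO (A ∩ Below (just (v n)))) → WO (A ∩ Below b)
      WO-below-step below-wo = wo-union Piece Piece-wo Piece-< ⋃-Piece
        where
        Piece-wo : ∀ n → WO (Piece n)
        Piece-wo n with admissible? b n
        ... | no ¬adm = wo-empty (λ _ (adm , _) → ¬adm adm)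
        ... | yes adm = WO-resp-⇔ (WO-∩ (WO-≤ (proj₁ adm) (below-wo n adm)) (fresh? n))
                                  (λ _ → mk⇔ (adm ,_) proj₂)

    WO-below : ∀ (S : Stump) b → IsBar (λ s → s ∈ˢᵗ S × BreaksDescent b s) → WO (A ∩ Below b)
    WO-below empty    b bar with bar (λ _ → 0)
    ... | _ , () , _
    WO-below (node f) b bar =
      WO-below-step b (λ n adm → WO-below (f n) (just (v n)) (bar-below adm bar))

module _ {q : ℕ → ℚ} {α : ℕ → ℕ} {A : ℚ → Set} (enum : Enumerates q α A) where

  enumerated-∈ : ∀ {m} → α m > 0 → A (q (α m ∸ 1))
  enumerated-∈ {m} _ with α m in αm≡1+k
  ... | suc k = from (enum k) (m , αm≡1+k)

  ∈-enumerated : Surjective _≡_ _≡_ q → ∀ {x} → A x → ∃ λ m → α m > 0 × q (α m ∸ 1) ≡ x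
  ∈-enumerated surj {x} Ax with surj x
  ... | k , qk≡x with to (enum k) (subst A (sym (qk≡x refl)) Ax)
  ... | m , αm≡1+k = m , subst (_> 0) (sym αm≡1+k) z<s
                         , subst (λ j → q (j ∸ 1) ≡ x) (sym αm≡1+k) (qk≡x refl)

theorem6p5 : BarTheoremStump → BarInduction →
    (q : ℕ → ℚ) → IsEnumerationOfℚ q →
    (A : ℚ → Set) (α : ℕ → ℕ) → Enumerates q α A →
    Hyp q α → WO A
theorem6p5 barTheorem _ q (_ , surj) A α enum hyp =
  let S , S-bars = barTheorem (BreaksDescent nothing) (breaksDescent-isBar hyp)
      A-wo = WO-below (enumerated-∈ {A = A} enum) (∈-enumerated {A = A} enum surj)
                      S nothing S-bars
  in WO-resp-⇔ A-wo (λ _ → mk⇔ proj₁ (_, tt))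
  where open Descent (λ m → q (α m ∸ 1)) (λ m → 0 ℕ.<? α m)
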